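{- For any graph $G$ and integer $k\ge1$ we have $\chi_k(G)\le\bigl\lceil\frac1k\,\lambda_{k,1}(G)\bigr\rceil$ and $\mathit{ch}_k(G)\le\bigl\lceil\frac1k\,\lambda^l_{k,1}(G)\bigr\rceil$.
   Context: All graphs are finite and simple; colours are integers. For an integer $k\ge1$, a $k$-frugal colouring of $G$ is a proper vertex colouring such that no colour appears more than $k$ times in the neighbourhood of any vertex; $\chi_k(G)$ is the least number of colours in a $k$-frugal colouring. A $t$-list assignment $L$ assigns to each vertex $v$ a list $L(v)$ of $t$ integers; $\mathit{ch}_k(G)$ is the least $t$ such that for every $t$-list assignment $L$ there is a $k$-frugal colouring with each vertex $v$ coloured from $L(v)$. For integers $p,q\ge0$, an $L(p,q)$-labelling of $G$ is an assignment $f$ of integers to the vertices such that $|f(u)-f(v)|\ge p$ whenever $\mathrm{dist}(u,v)=1$ and $|f(u)-f(v)|\ge q$ whenever $\mathrm{dist}(u,v)=2$. $\lambda_{p,q}(G)$ is the smallest $t$ such that $G$ has an $L(p,q)$-labelling using labels from $\{1,2,\dots,t\}$. $\lambda^l_{p,q}(G)$ is the smallest $t$ such that for every $t$-list assignment $L$ there is an $L(p,q)$-labelling $f$ of $G$ with $f(v)\in L(v)$ for every vertex $v$. -}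

module Defs where

open import Data.Nat using (ℕ; zero; suc; _+_; _∸_; _≤_; _<_; NonZero)
open import Data.Nat.DivMod using (_/_)
open import Data.Integer as ℤ using (ℤ; +_; ∣_∣; _-_)
open import Data.Fin using (Fin)
open import Data.List using (List; length; filter; allFin)
open import Data.List.Membership.Propositional using (_∈_)
open import Data.List.Relation.Unary.Unique.Propositional using (Unique)
open import Data.Product using (Σ; ∃; _×_; _,_)
open import Relation.Nullary using (¬_; Dec)
open import Relation.Nullary.Decidable using (_×-dec_)
open import Relation.Binary.PropositionalEquality using (_≡_)

record Graph (n : ℕ) : Set₁ where
  field
    Adj   : Fin n → Fin n → Set
    adj?  : (u v : Fin n) → Dec (Adj u v)
    sym   : ∀ {u v} → Adj u v → Adj v u
    irrefl : ∀ {u} → ¬ Adj u u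
open Graph public

module _ {n : ℕ} (G : Graph n) where

  Dist1 : Fin n → Fin n → Set
  Dist1 u v = Adj G u v

  Dist2 : Fin n → Fin n → Set
  Dist2 u v = ¬ (u ≡ v) × ¬ Adj G u v × ∃ λ w → Adj G u w × Adj G w v

  Proper : (Fin n → ℤ) → Set
  Proper f = ∀ u v → Adj G u v → ¬ (f u ≡ f v)

  nbrsColoured : (Fin n → ℤ) → Fin n → ℤ → ℕ
  nbrsColoured f v c =
    length (filter (λ u → adj? G v u ×-dec (f u ℤ.≟ c)) (allFin n))

  Frugal : ℕ → (Fin n → ℤ) → Set
  Frugal k f = Proper f × (∀ v c → nbrsColoured f v c ≤ k)

  LabellingPQ : ℕ → ℕ → (Fin n → ℤ) → Set
  LabellingPQ p q f =
      (∀ u v → Dist1 u v → p ≤ ∣ f u - f v ∣)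
    × (∀ u v → Dist2 u v → q ≤ ∣ f u - f v ∣)

  InRange : ℕ → (Fin n → ℤ) → Set
  InRange t f = ∀ v → (+ 1 ℤ.≤ f v) × (f v ℤ.≤ + t)

  ListAssignment : ℕ → Set
  ListAssignment t = (v : Fin n) → Σ (List ℤ) λ l → Unique l × length l ≡ t

  FromLists : ∀ {t} → ListAssignment t → (Fin n → ℤ) → Set
  FromLists L f = ∀ v → f v ∈ Data.Product.proj₁ (L v)

  ChiFrugalAtMost : ℕ → ℕ → Set
  ChiFrugalAtMost k m = ∃ λ f → Frugal k f × InRange m f

  LambdaAtMost : ℕ → ℕ → ℕ → Set
  LambdaAtMost p q t = ∃ λ f → LabellingPQ p q f × InRange t f

  -- G is k-frugally t-choosable, i.e. ch_k(G) ≤ t (property is monotone in t)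
  FrugalChoosable : ℕ → ℕ → Set
  FrugalChoosable k t = (L : ListAssignment t) → ∃ λ f → Frugal k f × FromLists L f

  LabelChoosable : ℕ → ℕ → ℕ → Set
  LabelChoosable p q t = (L : ListAssignment t) → ∃ λ f → LabellingPQ p q f × FromLists L f

ceilDiv : (t k : ℕ) → .{{NonZero k}} → ℕ
ceilDiv t k = (t + k ∸ 1) / k

-- Cut the integers into blocks of k consecutive labels, block c being {ck, …, ck + k − 1}, and colour
-- a vertex by the block of its label. Adjacent vertices have labels at distance at least k, so they lie
-- in different blocks. Two neighbours of a common vertex are at distance at most 2, so their labels
-- differ; hence at most k neighbours of any vertex fall into one block. Labels in {1, …, t}, shifted by
-- k − 1, land in the blocks 1, …, ⌈t/k⌉. For lists, a list of ⌈t/k⌉ colours is replaced by the union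
-- of their blocks, which contains at least t labels, and the colour of the chosen label is its block.
module Submission where

open import Defs
open import Data.Nat as ℕ using (ℕ; NonZero; suc; _∸_; _≤_; _<_; z≤n; s≤s; z<s; >-nonZero⁻¹)
import Data.Nat.Properties as ℕₚ
import Data.Nat.DivMod as ℕ
open import Data.Integer as ℤ using (ℤ; +_; _+_; _-_; _*_; ∣_∣; +≤+; +<+)
import Data.Integer.Properties as ℤₚ
open import Data.Integer.DivMod using (_/ℕ_; _%ℕ_; n%ℕd<d; a≡a%ℕn+[a/ℕn]*n)
open import Data.Integer.Tactic.RingSolver using (solve-∀)
import Data.Fin as Fin
open import Data.List using (List; []; _∷_; _++_; length; map; upTo; take; filter; allFin)
import Data.List.Properties as List
open import Data.List.Membership.Propositional using (_∈_)
open import Data.List.Membership.Propositional.Properties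
  using (∈-map⁺; ∈-map⁻; ∈-upTo⁺; ∈-upTo⁻; ∈-++⁻; ∈-filter⁻; ∈-∃++)
open import Data.List.Relation.Unary.Any using (here; there)
import Data.List.Relation.Unary.All as All
open import Data.List.Relation.Unary.AllPairs using ([]; _∷_)
open import Data.List.Relation.Unary.Unique.Propositional using (Unique)
import Data.List.Relation.Unary.Unique.Propositional.Properties as Unique
open import Data.List.Relation.Binary.Sublist.Propositional using (lookup)
open import Data.List.Relation.Binary.Sublist.Propositional.Properties using (take-⊆)
open import Data.Product using (_×_; _,_; proj₁; proj₂)
open import Data.Sum using (inj₁; inj₂)
open import Data.Empty using (⊥-elim)
open import Relation.Nullary using (¬_; yes; no)
open import Relation.Nullary.Decidable using (_×-dec_)
open import Relation.Binary using (tri<; tri≈; tri>)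
open import Relation.Binary.PropositionalEquality as ≡
  using (_≡_; _≢_; refl; cong; cong₂; subst; trans)

module _ {a} {A : Set a} where

  ∈-++-∷⁻ : ∀ {y z : A} as bs → y ∈ as ++ z ∷ bs → y ≢ z → y ∈ as ++ bs
  ∈-++-∷⁻ []       bs (here y≡z)  y≢z = ⊥-elim (y≢z y≡z)
  ∈-++-∷⁻ []       bs (there y∈)  y≢z = y∈
  ∈-++-∷⁻ (x ∷ as) bs (here y≡x)  y≢z = here y≡x
  ∈-++-∷⁻ (x ∷ as) bs (there y∈)  y≢z = there (∈-++-∷⁻ as bs y∈ y≢z)

  length-++-∷ : ∀ as bs (z : A) → length (as ++ z ∷ bs) ≡ suc (length (as ++ bs))
  length-++-∷ []       bs z = refl
  length-++-∷ (x ∷ as) bs z = cong suc (length-++-∷ as bs z)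

module _ {a b} {A : Set a} {B : Set b} where

  injectiveOn⇒length≤ : ∀ (g : A → B) {xs ys} → Unique xs →
    (∀ {x y} → x ∈ xs → y ∈ xs → g x ≡ g y → x ≡ y) →
    (∀ {x} → x ∈ xs → g x ∈ ys) →
    length xs ≤ length ys
  injectiveOn⇒length≤ g {[]}     _            inj into = z≤n
  injectiveOn⇒length≤ g {x ∷ xs} (x∉xs ∷ xs!) inj into
    with as , bs , refl ← ∈-∃++ (into (here refl)) =
    subst (suc (length xs) ≤_) (≡.sym (length-++-∷ as bs (g x)))
      (s≤s (injectiveOn⇒length≤ g xs!
        (λ y∈ z∈ → inj (there y∈) (there z∈))
        (λ y∈ → ∈-++-∷⁻ as bs (into (there y∈))
                   (λ gy≡gx → All.lookup x∉xs y∈ (inj (here refl) (there y∈) (≡.sym gy≡gx))))))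

∣+m-+n∣<o : ∀ {m n o} → m < o → n < o → ∣ + m - + n ∣ < o
∣+m-+n∣<o {m} {n} m<o n<o =
  subst (_< _) (cong ∣_∣ (≡.sym (ℤₚ.m-n≡m⊖n m n)))
    (ℕₚ.≤-<-trans (ℤₚ.∣m⊝n∣≤m⊔n m n) (ℕₚ.⊔-pres-<m m<o n<o))

[i+j]-j≡i : ∀ i j → (i + j) - j ≡ i
[i+j]-j≡i = solve-∀

[i+k]-[j+k]≡i-j : ∀ i j k → (i + k) - (j + k) ≡ i - j
[i+k]-[j+k]≡i-j = solve-∀

≡⇒∣i-j∣≡0 : ∀ {i j} → i ≡ j → ∣ i - j ∣ ≡ 0
≡⇒∣i-j∣≡0 {i} refl = cong ∣_∣ (ℤₚ.+-inverseʳ i)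

module _ {n} (G : Graph n) where

  labelling-+ : ∀ {p q} f z → LabellingPQ G p q f → LabellingPQ G p q (λ v → f v + z)
  labelling-+ f z (far₁ , far₂) =
      (λ u v uv → subst (_ ≤_) (shift u v) (far₁ u v uv))
    , (λ u v uv → subst (_ ≤_) (shift u v) (far₂ u v uv))
    where
    shift : ∀ u v → ∣ f u - f v ∣ ≡ ∣ (f u + z) - (f v + z) ∣
    shift u v = cong ∣_∣ (≡.sym ([i+k]-[j+k]≡i-j (f u) (f v) z))

  labelling-common-neighbour-≢ : ∀ {p f v u w} → 1 ≤ p → LabellingPQ G p 1 f →
    Adj G v u → Adj G v w → u ≢ w → f u ≢ f w
  labelling-common-neighbour-≢ {v = v} {u} {w} 1≤p (far₁ , far₂) vu vw u≢w fu≡fw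
    with adj? G u w
  ... | yes uw = ℕₚ.<⇒≱ z<s (ℕₚ.≤-trans 1≤p (subst (_ ≤_) (≡⇒∣i-j∣≡0 fu≡fw) (far₁ u w uw)))
  ... | no ¬uw = ℕₚ.<⇒≱ z<s
                   (subst (_ ≤_) (≡⇒∣i-j∣≡0 fu≡fw) (far₂ u w (u≢w , ¬uw , v , sym G vu , vw)))

module Blocks (k : ℕ) .{{_ : NonZero k}} where

  block : ℤ → ℤ
  block x = x /ℕ k

  member : ℤ → ℕ → ℤ
  member c j = + j + c * + k

  members : ℤ → List ℤ
  members c = map (member c) (upTo k)

  length-members : ∀ c → length (members c) ≡ k
  length-members c = trans (List.length-map (member c) (upTo k)) (List.length-upTo k)

  member-injective : ∀ c {i j} → member c i ≡ member c j → i ≡ j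
  member-injective c {i} {j} eq = ℤₚ.+-injective (begin
    + i                    ≡⟨ [i+j]-j≡i (+ i) (c * + k) ⟨
    member c i - c * + k   ≡⟨ cong (_- c * + k) eq ⟩
    member c j - c * + k   ≡⟨ [i+j]-j≡i (+ j) (c * + k) ⟩
    + j                    ∎)
    where open ≡.≡-Reasoning

  members-unique : ∀ c → Unique (members c)
  members-unique c = Unique.map⁺ (member-injective c) (Unique.upTo⁺ k)

  member<member : ∀ {c d i j} → i < k → c ℤ.< d → member c i ℤ.< member d j
  member<member {c} {d} {i} {j} i<k c<d = begin-strict
    + i + c * + k      <⟨ ℤₚ.+-monoˡ-< (c * + k) (+<+ i<k) ⟩
    + k + c * + k      ≡⟨ ℤₚ.suc-* c (+ k) ⟨
    ℤ.suc c * + k      ≤⟨ ℤₚ.*-monoʳ-≤-nonNeg (+ k) (ℤₚ.i<j⇒suc[i]≤j c<d) ⟩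
    d * + k            ≤⟨ ℤₚ.i≤j+i (d * + k) (+ j) ⟩
    + j + d * + k      ∎
    where open ℤₚ.≤-Reasoning

  member-injectiveˡ : ∀ {c d i j} → i < k → j < k → member c i ≡ member d j → c ≡ d
  member-injectiveˡ {c} {d} i<k j<k eq with ℤₚ.<-cmp c d
  ... | tri< c<d _ _ = ⊥-elim (ℤₚ.<⇒≢ (member<member i<k c<d) eq)
  ... | tri≈ _ c≡d _ = c≡d
  ... | tri> _ _ d<c = ⊥-elim (ℤₚ.<⇒≢ (member<member j<k d<c) (≡.sym eq))

  member-block : ∀ x → x ≡ member (block x) (x %ℕ k)
  member-block x = a≡a%ℕn+[a/ℕn]*n x k

  block-member : ∀ c {j} → j < k → block (member c j) ≡ c
  block-member c {j} j<k =
    ≡.sym (member-injectiveˡ j<k (n%ℕd<d (member c j) k) (member-block (member c j)))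

  ∈-members : ∀ x → x ∈ members (block x)
  ∈-members x = subst (_∈ members (block x)) (≡.sym (member-block x))
                  (∈-map⁺ (member (block x)) (∈-upTo⁺ (n%ℕd<d x k)))

  ∈-members⇒block≡ : ∀ {x c} → x ∈ members c → block x ≡ c
  ∈-members⇒block≡ {c = c} x∈ with ∈-map⁻ (member c) x∈
  ... | j , j∈ , refl = block-member c (∈-upTo⁻ j∈)

  block≡⇒∣x-y∣<k : ∀ x y → block x ≡ block y → ∣ x - y ∣ < k
  block≡⇒∣x-y∣<k x y eq =
    subst (λ z → ∣ z ∣ < k) (≡.sym x-y≡r-s) (∣+m-+n∣<o (n%ℕd<d x k) (n%ℕd<d y k))
    where
    open ≡.≡-Reasoning
    r = x %ℕ k
    s = y %ℕ k
    x-y≡r-s : x - y ≡ + r - + s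
    x-y≡r-s = begin
      x - y                                   ≡⟨ cong₂ _-_ (member-block x) (member-block y) ⟩
      member (block x) r - member (block y) s ≡⟨ cong (λ c → member (block x) r - member c s) eq ⟨
      member (block x) r - member (block x) s ≡⟨ [i+k]-[j+k]≡i-j (+ r) (+ s) (block x * + k) ⟩
      + r - + s                               ∎

  block-frugal : ∀ {n} (G : Graph n) f → LabellingPQ G k 1 f → Frugal G k (λ v → block (f v))
  block-frugal {n} G f labelling@(far₁ , _) = proper , fewPerColour
    where
    proper : Proper G (λ v → block (f v))
    proper u v uv eq = ℕₚ.<⇒≱ (block≡⇒∣x-y∣<k (f u) (f v) eq) (far₁ u v uv)

    fewPerColour : ∀ v c → nbrsColoured G (λ v → block (f v)) v c ≤ k
    fewPerColour v c = subst (length U ≤_) (length-members c)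
      (injectiveOn⇒length≤ f (Unique.filter⁺ P? (Unique.allFin⁺ n)) injectiveOnU into)
      where
      P? = λ u → adj? G v u ×-dec (block (f u) ℤ.≟ c)
      U = filter P? (allFin n)
      ∈U⁻ : ∀ {u} → u ∈ U → Adj G v u × block (f u) ≡ c
      ∈U⁻ u∈ = proj₂ (∈-filter⁻ P? {xs = allFin n} u∈)
      into : ∀ {u} → u ∈ U → f u ∈ members c
      into {u} u∈ = subst (λ d → f u ∈ members d) (proj₂ (∈U⁻ u∈)) (∈-members (f u))
      injectiveOnU : ∀ {u w} → u ∈ U → w ∈ U → f u ≡ f w → u ≡ w
      injectiveOnU {u} {w} u∈ w∈ eq with u Fin.≟ w
      ... | yes u≡w = u≡w
      ... | no u≢w = ⊥-elim (labelling-common-neighbour-≢ G (>-nonZero⁻¹ k) labelling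
                       (proj₁ (∈U⁻ u∈)) (proj₁ (∈U⁻ w∈)) u≢w eq)

  ceilBlock : ℤ → ℤ
  ceilBlock x = block (x + + (k ∸ 1))

  ceilBlock-range : ∀ {t x} → + 1 ℤ.≤ x → x ℤ.≤ + t →
    (+ 1 ℤ.≤ ceilBlock x) × (ceilBlock x ℤ.≤ + ceilDiv t k)
  ceilBlock-range {t} {+ m} (+≤+ 1≤m) (+≤+ m≤t) =
    +≤+ (ℕ.m≥n⇒m/n>0 k≤m+k∸1) , +≤+ (ℕ./-mono-≤ m+k∸1≤t+k∸1 ℕₚ.≤-refl)
    where
    1≤k : 1 ≤ k
    1≤k = >-nonZero⁻¹ k
    k≤m+k∸1 : k ≤ m ℕ.+ (k ∸ 1)
    k≤m+k∸1 = subst (_≤ m ℕ.+ (k ∸ 1)) (ℕₚ.m+[n∸m]≡n 1≤k) (ℕₚ.+-monoˡ-≤ (k ∸ 1) 1≤m)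
    m+k∸1≤t+k∸1 : m ℕ.+ (k ∸ 1) ≤ t ℕ.+ k ∸ 1
    m+k∸1≤t+k∸1 = subst (m ℕ.+ (k ∸ 1) ≤_) (≡.sym (ℕₚ.+-∸-assoc t 1≤k)) (ℕₚ.+-monoˡ-≤ (k ∸ 1) m≤t)

  χ-bound : ∀ {n} (G : Graph n) t → LambdaAtMost G k 1 t → ChiFrugalAtMost G k (ceilDiv t k)
  χ-bound G t (f , labelling , inRange) =
      (λ v → ceilBlock (f v))
    , block-frugal G (λ v → f v + + (k ∸ 1)) (labelling-+ G f (+ (k ∸ 1)) labelling)
    , λ v → ceilBlock-range (proj₁ (inRange v)) (proj₂ (inRange v))

  blocks : List ℤ → List ℤ
  blocks []       = []
  blocks (c ∷ cs) = members c ++ blocks cs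

  length-blocks : ∀ cs → length (blocks cs) ≡ length cs ℕ.* k
  length-blocks []       = refl
  length-blocks (c ∷ cs) =
    trans (List.length-++ (members c)) (cong₂ ℕ._+_ (length-members c) (length-blocks cs))

  ∈-blocks⇒block∈ : ∀ {x} cs → x ∈ blocks cs → block x ∈ cs
  ∈-blocks⇒block∈ (c ∷ cs) x∈ with ∈-++⁻ (members c) x∈
  ... | inj₁ x∈c  = here (∈-members⇒block≡ x∈c)
  ... | inj₂ x∈cs = there (∈-blocks⇒block∈ cs x∈cs)

  blocks-unique : ∀ {cs} → Unique cs → Unique (blocks cs)
  blocks-unique {[]}     []            = []
  blocks-unique {c ∷ cs} (c∉cs ∷ cs!) = Unique.++⁺ (members-unique c) (blocks-unique cs!) disjoint
    where
    disjoint : ∀ {x} → ¬ (x ∈ members c × x ∈ blocks cs)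
    disjoint (x∈c , x∈cs) =
      All.lookup c∉cs (∈-blocks⇒block∈ cs x∈cs) (≡.sym (∈-members⇒block≡ x∈c))

  ≤-ceilDiv*k : ∀ t → t ≤ ceilDiv t k ℕ.* k
  ≤-ceilDiv*k t = ℕₚ.+-cancelʳ-≤ (k ∸ 1) t (q ℕ.* k) (begin
    t ℕ.+ (k ∸ 1)       ≡⟨ ℕₚ.+-∸-assoc t (>-nonZero⁻¹ k) ⟨
    t ℕ.+ k ∸ 1         ≡⟨ ℕ.m≡m%n+[m/n]*n (t ℕ.+ k ∸ 1) k ⟩
    r ℕ.+ q ℕ.* k       ≤⟨ ℕₚ.+-monoˡ-≤ (q ℕ.* k) r≤k∸1 ⟩
    (k ∸ 1) ℕ.+ q ℕ.* k ≡⟨ ℕₚ.+-comm (k ∸ 1) (q ℕ.* k) ⟩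
    q ℕ.* k ℕ.+ (k ∸ 1) ∎)
    where
    open ℕₚ.≤-Reasoning
    q = ceilDiv t k
    r = (t ℕ.+ k ∸ 1) ℕ.% k
    r≤k∸1 : r ≤ k ∸ 1
    r≤k∸1 = ℕₚ.∸-monoˡ-≤ 1 (ℕ.m%n<n (t ℕ.+ k ∸ 1) k)

  expandLists : ∀ {n} (G : Graph n) t → ListAssignment G (ceilDiv t k) → ListAssignment G t
  expandLists G t L v = take t (blocks cs) , Unique.take⁺ t (blocks-unique cs!) , length≡t
    where
    cs = proj₁ (L v)
    cs! = proj₁ (proj₂ (L v))
    length≡t : length (take t (blocks cs)) ≡ t
    length≡t = trans (List.length-take t (blocks cs)) (ℕₚ.m≤n⇒m⊓n≡m
      (subst (t ≤_) (≡.sym (trans (length-blocks cs) (cong (ℕ._* k) (proj₂ (proj₂ (L v))))))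
        (≤-ceilDiv*k t)))

  ch-bound : ∀ {n} (G : Graph n) t → LabelChoosable G k 1 t → FrugalChoosable G k (ceilDiv t k)
  ch-bound G t choose L with f , labelling , fromLists ← choose (expandLists G t L) =
      (λ v → block (f v))
    , block-frugal G f labelling
    , λ v → ∈-blocks⇒block∈ (proj₁ (L v)) (lookup (take-⊆ t _) (fromLists v))

proposition5 : {n : ℕ} (G : Graph n) (k : ℕ) .{{_ : NonZero k}} →
    ((t : ℕ) → LambdaAtMost G k 1 t → ChiFrugalAtMost G k (ceilDiv t k))
    × ((t : ℕ) → LabelChoosable G k 1 t → FrugalChoosable G k (ceilDiv t k))
proposition5 G k = Blocks.χ-bound k G , Blocks.ch-bound k G
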